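{- Let $A$ be a finite subset of $M_n$. Then $\operatorname{acl}_{M_n}(A)=\operatorname{cl}(A)$.
   Context: Let $n\geq 2$ and $\Omega$ a countably infinite set; $[X]^m$ is the set of $m$-subsets of $X$. $\beta^\ast_{n,n-1}:\mathbb{F}_2^{[\Omega]^{n-1}}\to\mathbb{F}_2^{[\Omega]^n}$, $(\beta^\ast_{n,n-1}f)(\omega)=\sum_{x\in[\omega]^{n-1}}f(x)$, where $\mathbb{F}_2^{[\Omega]^m}$ is the group of functions $[\Omega]^m\to\mathbb{F}_2$. $M_n$ is the countable multisorted structure with sorts $\Omega$, $[\Omega]^n$, $[\Omega]^n\times\mathbb{F}_2$ whose automorphism group is $G=\operatorname{Im}\beta^\ast_{n,n-1}\rtimes\operatorname{Sym}(\Omega)$ (e.g. with the $G$-orbits on finite tuples as basic relations), where $g\sigma$ acts on $\Omega$ and $[\Omega]^n$ via $\sigma$ and by $(w,x)\mapsto(w^\sigma,x+g(w))$ on $[\Omega]^n\times\mathbb{F}_2$. $\operatorname{acl}_{M_n}(A)$ is the union of the finite orbits of $\operatorname{Aut}(M_n/A)$ (pointwise stabilizer of $A$) on $M_n$. For finite $A\subseteq M_n$ with parts $A_1,A_2,A_3$ in the sorts $\Omega$, $[\Omega]^n$, $[\Omega]^n\times\mathbb{F}_2$: $\operatorname{supp}(A)=A_1\cup\bigcup A_2\cup\bigcup\pi(A_3)\subseteq\Omega$ ($\pi$ the first projection) and $\operatorname{cl}(A)=\operatorname{supp}(A)\cup[\operatorname{supp}(A)]^n\cup([\operatorname{supp}(A)]^n\times\mathbb{F}_2)$.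 -}

module Defs where

open import Data.Nat using (ℕ; _<_; _≤?_)
open import Data.Bool using (Bool; true; false; _xor_; if_then_else_)
open import Data.List using (List; []; _∷_; map; foldr; length; _++_)
open import Data.List.Relation.Unary.All using (All)
open import Data.List.Relation.Unary.Linked using (Linked)
open import Data.List.Membership.Propositional using (_∈_)
open import Data.Product using (_×_; ∃)
open import Data.Unit using (⊤)
open import Relation.Nullary using (does)
open import Relation.Binary.PropositionalEquality using (_≡_)
open import Function.Bundles using (_↔_; Inverse)

-- Ω is ℕ.  An m-subset of Ω is represented canonically by the strictly
-- increasing list of its elements.
IsSubset : ℕ → List ℕ → Set
IsSubset m w = Linked _<_ w × length w ≡ m

insert : ℕ → List ℕ → List ℕ
insert x [] = x ∷ []
insert x (y ∷ ys) = if does (x ≤? y) then x ∷ y ∷ ys else y ∷ insert x ys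

sortℕ : List ℕ → List ℕ
sortℕ [] = []
sortℕ (x ∷ xs) = insert x (sortℕ xs)

image : (ℕ → ℕ) → List ℕ → List ℕ
image σ w = sortℕ (map σ w)

removals : List ℕ → List (List ℕ)
removals [] = []
removals (x ∷ xs) = xs ∷ map (x ∷_) (removals xs)

-- β*_{n,n-1} f evaluated at an n-subset ω : sum over [ω]^{n-1} in F₂ (= Bool, xor)
βstar : (List ℕ → Bool) → List ℕ → Bool
βstar f w = foldr _xor_ false (map f (removals w))

-- elements of the multisorted structure M_n (all three sorts)
data M : Set where
  pt   : ℕ → M
  nset : List ℕ → M
  tag  : List ℕ → Bool → M

Valid : ℕ → M → Set
Valid n (pt x) = ⊤
Valid n (nset w) = IsSubset n w
Valid n (tag w b) = IsSubset n w

-- elements g σ of G = Im β*_{n,n-1} ⋊ Sym(Ω)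
record G (n : ℕ) : Set where
  field
    g    : List ℕ → Bool          -- g ∈ F₂^{[Ω]^n} (values on n-subsets matter)
    σ    : ℕ ↔ ℕ
    inIm : ∃ λ (f : List ℕ → Bool) → ∀ w → IsSubset n w → g w ≡ βstar f w

act : ∀ {n} → G n → M → M
act γ (pt x) = pt (Inverse.to (G.σ γ) x)
act γ (nset w) = nset (image (Inverse.to (G.σ γ)) w)
act γ (tag w b) = tag (image (Inverse.to (G.σ γ)) w) (b xor G.g γ w)

Fixes : ∀ {n} → G n → List M → Set
Fixes γ A = All (λ a → act γ a ≡ a) A

-- x ∈ acl(A) : the Aut(M_n/A)-orbit of x is finite (contained in a finite list)
InAcl : ℕ → List M → M → Set
InAcl n A x = ∃ λ (L : List M) → (γ : G n) → Fixes γ A → act γ x ∈ L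

supp : List M → List ℕ
supp [] = []
supp (pt x ∷ A) = x ∷ supp A
supp (nset w ∷ A) = w ++ supp A
supp (tag w b ∷ A) = w ++ supp A

InCl : List M → M → Set
InCl A (pt x) = x ∈ supp A
InCl A (nset w) = All (_∈ supp A) w
InCl A (tag w b) = All (_∈ supp A) w

-- An automorphism fixing A pointwise permutes supp(A), so it maps an element x with
-- supp(x) ⊆ supp(A) to one of the finitely many elements of the same sort with support
-- in supp(A). Conversely, if some z ∈ supp(x) lies outside supp(A), the transposition
-- of z with any point y outside supp(A) fixes A, and its images of x have y in their
-- support; y ranges over infinitely many points, so no finite list contains the orbit.
-- Only the Sym(Ω) part of G is needed.

module Submission where

open import Defs
open import Data.Nat using (ℕ; _≤_)
open import Data.List using (List)
open import Data.List.Relation.Unary.All using (All)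
open import Function.Bundles using (_⇔_)

open import Data.Bool using (true; false; _xor_)
open import Data.Bool.Properties using (xor-identityʳ)
open import Data.List using ([]; _∷_; map; foldr; length; _++_; concatMap; cartesianProductWith)
open import Data.List.Extrema.Nat using (max; xs≤max)
open import Data.List.Membership.Propositional using (_∈_; _∉_; lose; find)
open import Data.List.Membership.Propositional.Properties
  using (∈-map⁺; ∈-map⁻; ∈-++⁺ˡ; ∈-++⁺ʳ; ∈-++⁻; ∈-concatMap⁺; ∈-cartesianProductWith⁺)
open import Data.List.Properties using (length-map; map-id-local)
open import Data.List.Relation.Binary.Permutation.Propositional using (_↭_; refl; prep; swap; ↭-trans; ↭-sym)
open import Data.List.Relation.Binary.Permutation.Propositional.Properties using (∈-resp-↭; ↭-length)
open import Data.List.Relation.Unary.All using ([]; _∷_; all?; tabulate; lookup)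
open import Data.List.Relation.Unary.All.Properties using (¬All⇒Any¬; ++⁻)
open import Data.List.Relation.Unary.Any using (here; there)
open import Data.List.Relation.Unary.Linked using (Linked; []; [-]; _∷_)
open import Data.Nat using (zero; suc; _<_; _≤ᵇ_; _≟_)
open import Data.List.Membership.DecPropositional _≟_ using (_∈?_)
open import Data.Nat.Properties using (<⇒≤; ≤⇒≤ᵇ; <-irrefl)
open import Data.Product using (∃; _×_; _,_)
open import Data.Sum using (inj₁; inj₂)
open import Function using (id)
open import Function.Bundles using (_↔_; Inverse; mk↔ₛ′; mk⇔; Equivalence)
open import Relation.Binary.Definitions using (DecidableEquality)
open import Relation.Binary.PropositionalEquality using (_≡_; _≢_; refl; sym; trans; cong; cong₂; subst)
open import Relation.Nullary using (¬_; yes; no; contradiction)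

insert-↭ : ∀ x xs → insert x xs ↭ x ∷ xs
insert-↭ x []       = refl
insert-↭ x (y ∷ ys) with x ≤ᵇ y
... | true  = refl
... | false = ↭-trans (prep y (insert-↭ x ys)) (swap y x refl)

sortℕ-↭ : ∀ xs → sortℕ xs ↭ xs
sortℕ-↭ []       = refl
sortℕ-↭ (x ∷ xs) = ↭-trans (insert-↭ x (sortℕ xs)) (prep x (sortℕ-↭ xs))

insert-head : ∀ {x xs} → Linked _<_ (x ∷ xs) → insert x xs ≡ x ∷ xs
insert-head {xs = []}     _           = refl
insert-head {x} {y ∷ ys} (x<y ∷ _) with x ≤ᵇ y | ≤⇒≤ᵇ (<⇒≤ x<y)
... | true  | _  = refl
... | false | ()

sortℕ-sorted : ∀ {xs} → Linked _<_ xs → sortℕ xs ≡ xs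
sortℕ-sorted []                        = refl
sortℕ-sorted {x ∷ []}     [-]          = refl
sortℕ-sorted {x ∷ y ∷ ys} l@(_ ∷ l′)
  rewrite sortℕ-sorted l′ = insert-head l

module _ (σ : ℕ → ℕ) where

  ∈-image⁺ : ∀ {z w} → z ∈ w → σ z ∈ image σ w
  ∈-image⁺ {w = w} z∈w = ∈-resp-↭ (↭-sym (sortℕ-↭ (map σ w))) (∈-map⁺ σ z∈w)

  ∈-image⁻ : ∀ {z w} → z ∈ image σ w → ∃ λ y → y ∈ w × z ≡ σ y
  ∈-image⁻ {w = w} z∈σw = ∈-map⁻ σ (∈-resp-↭ (sortℕ-↭ (map σ w)) z∈σw)

  length-image : ∀ w → length (image σ w) ≡ length w
  length-image w = trans (↭-length (sortℕ-↭ (map σ w))) (length-map σ w)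

  image-fixed : ∀ {w} → Linked _<_ w → All (λ z → σ z ≡ z) w → image σ w ≡ w
  image-fixed sorted fixed = trans (cong sortℕ (map-id-local fixed)) (sortℕ-sorted sorted)

module _ {A : Set} (_≟_ : DecidableEquality A) where

  transpose : A → A → A → A
  transpose z y a with a ≟ z | a ≟ y
  ... | yes _ | _     = y
  ... | no  _ | yes _ = z
  ... | no  _ | no  _ = a

  transpose-left : ∀ z y → transpose z y z ≡ y
  transpose-left z y with z ≟ z
  ... | yes _   = refl
  ... | no  z≢z = contradiction refl z≢z

  transpose-right : ∀ z y → transpose z y y ≡ z
  transpose-right z y with y ≟ z | y ≟ y
  ... | yes y≡z | _       = y≡z
  ... | no  _   | yes _   = refl
  ... | no  _   | no  y≢y = contradiction refl y≢y

  transpose-other : ∀ {z y a} → a ≢ z → a ≢ y → transpose z y a ≡ a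
  transpose-other {z} {y} {a} a≢z a≢y with a ≟ z | a ≟ y
  ... | yes a≡z | _       = contradiction a≡z a≢z
  ... | no  _   | yes a≡y = contradiction a≡y a≢y
  ... | no  _   | no  _   = refl

  transpose-involutive : ∀ z y a → transpose z y (transpose z y a) ≡ a
  transpose-involutive z y a with a ≟ z | a ≟ y
  ... | yes refl | _        = transpose-right a y
  ... | no  _    | yes refl = transpose-left z a
  ... | no  a≢z  | no  a≢y  = transpose-other a≢z a≢y

  transposition : A → A → A ↔ A
  transposition z y = mk↔ₛ′ (transpose z y) (transpose z y)
    (transpose-involutive z y) (transpose-involutive z y)

support : M → List ℕ
support (pt x)    = x ∷ []
support (nset w)  = w
support (tag w _) = w

supp-∷ : ∀ a A → supp (a ∷ A) ≡ support a ++ supp A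
supp-∷ (pt _)    _ = refl
supp-∷ (nset _)  _ = refl
supp-∷ (tag _ _) _ = refl

InCl⇔support⊆supp : ∀ A x → InCl A x ⇔ All (_∈ supp A) (support x)
InCl⇔support⊆supp A (pt x)    = mk⇔ (_∷ []) (λ { (x∈A ∷ []) → x∈A })
InCl⇔support⊆supp A (nset w)  = mk⇔ id id
InCl⇔support⊆supp A (tag w _) = mk⇔ id id

words : List ℕ → ℕ → List (List ℕ)
words S zero    = [] ∷ []
words S (suc k) = cartesianProductWith _∷_ S (words S k)

∈-words : ∀ {S v} → All (_∈ S) v → v ∈ words S (length v)
∈-words []            = here refl
∈-words (x∈S ∷ v⊆S) = ∈-cartesianProductWith⁺ _∷_ x∈S (∈-words v⊆S)

relabellings : List ℕ → M → List M
relabellings S (pt _)    = map pt S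
relabellings S (nset w)  = map nset (words S (length w))
relabellings S (tag w _) = cartesianProductWith tag (words S (length w)) (true ∷ false ∷ [])

module _ {n : ℕ} (γ : G n) where

  private
    σ = Inverse.to (G.σ γ)

  support-act : ∀ x → support (act γ x) ≡ image σ (support x)
  support-act (pt _)    = refl
  support-act (nset _)  = refl
  support-act (tag _ _) = refl

  ∈-support-act⁺ : ∀ {z} x → z ∈ support x → σ z ∈ support (act γ x)
  ∈-support-act⁺ x z∈x = subst (_ ∈_) (sym (support-act x)) (∈-image⁺ σ z∈x)

  supp-invariant : ∀ {A z} → Fixes γ A → z ∈ supp A → σ z ∈ supp A
  supp-invariant {a ∷ A} (γa≡a ∷ fixes) z∈aA
    with ∈-++⁻ (support a) (subst (_ ∈_) (supp-∷ a A) z∈aA)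
  ... | inj₁ z∈a = subst (_ ∈_) (sym (supp-∷ a A))
                     (∈-++⁺ˡ (subst (λ b → _ ∈ support b) γa≡a (∈-support-act⁺ a z∈a)))
  ... | inj₂ z∈A = subst (_ ∈_) (sym (supp-∷ a A))
                     (∈-++⁺ʳ (support a) (supp-invariant fixes z∈A))

  ∈-words-image : ∀ {S} w → All (_∈ S) (image σ w) → image σ w ∈ words S (length w)
  ∈-words-image {S} w σw⊆S = subst (λ k → image σ w ∈ words S k) (length-image σ w) (∈-words σw⊆S)

  ∈-relabellings : ∀ {S} x → All (_∈ S) (support (act γ x)) → act γ x ∈ relabellings S x
  ∈-relabellings (pt _)    (σx∈S ∷ []) = ∈-map⁺ pt σx∈S
  ∈-relabellings (nset w)  σw⊆S        = ∈-map⁺ nset (∈-words-image w σw⊆S)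
  ∈-relabellings (tag w b) σw⊆S        =
    ∈-cartesianProductWith⁺ tag (∈-words-image w σw⊆S) (∈-bools (b xor G.g γ w))
    where
    ∈-bools : ∀ c → c ∈ true ∷ false ∷ []
    ∈-bools true  = here refl
    ∈-bools false = there (here refl)

  orbit⊆relabellings : ∀ {A} → Fixes γ A → ∀ x → All (_∈ supp A) (support x) →
                       act γ x ∈ relabellings (supp A) x
  orbit⊆relabellings {A} fixes x x⊆A = ∈-relabellings x
    (subst (All _) (sym (support-act x)) (tabulate image⊆A))
    where
    image⊆A : ∀ {z} → z ∈ image σ (support x) → z ∈ supp A
    image⊆A z∈σx with y , y∈x , refl ← ∈-image⁻ σ z∈σx = supp-invariant fixes (lookup x⊆A y∈x)

permutationAut : ∀ n → ℕ ↔ ℕ → G n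
permutationAut n π = record
  { g    = λ _ → false
  ; σ    = π
  ; inIm = (λ _ → false) , λ w _ → sym (βstar-zero w)
  }
  where
  βstar-zero : ∀ w → βstar (λ _ → false) w ≡ false
  βstar-zero w = xor-zeros (removals w)
    where
    xor-zeros : ∀ (ws : List (List ℕ)) → foldr _xor_ false (map (λ _ → false) ws) ≡ false
    xor-zeros []       = refl
    xor-zeros (_ ∷ ws) = xor-zeros ws

module _ {n : ℕ} (π : ℕ ↔ ℕ) where

  private
    σ = Inverse.to π

  permutationAut-fixes : ∀ {x} → Valid n x → All (λ z → σ z ≡ z) (support x) →
                         act (permutationAut n π) x ≡ x
  permutationAut-fixes {pt _}    _           (σx≡x ∷ []) = cong pt σx≡x
  permutationAut-fixes {nset _}  (sorted , _) fixed      = cong nset (image-fixed σ sorted fixed)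
  permutationAut-fixes {tag _ b} (sorted , _) fixed      =
    cong₂ tag (image-fixed σ sorted fixed) (xor-identityʳ b)

  Fixes-permutationAut : ∀ {A} → All (Valid n) A → All (λ z → σ z ≡ z) (supp A) →
                         Fixes (permutationAut n π) A
  Fixes-permutationAut {[]}    []            _     = []
  Fixes-permutationAut {a ∷ A} (valid ∷ vs) fixed
    with fixed-a , fixed-A ← ++⁻ (support a) (subst (All _) (supp-∷ a A) fixed)
    = permutationAut-fixes valid fixed-a ∷ Fixes-permutationAut vs fixed-A

fresh : ∀ xs → suc (max 0 xs) ∉ xs
fresh xs p = <-irrefl refl (lookup (xs≤max 0 xs) p)

∉supp⇒∉acl : ∀ {n A x z} → All (Valid n) A → z ∈ support x → z ∉ supp A → ¬ InAcl n A x
∉supp⇒∉acl {n} {A} {x} {z} valid z∈x z∉A (L , orbit⊆L) = fresh S (∈-++⁺ˡ y∈L)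
  where
  S = concatMap support L ++ supp A
  y = suc (max 0 S)
  y∉A : y ∉ supp A
  y∉A y∈A = fresh S (∈-++⁺ʳ (concatMap support L) y∈A)
  π = transposition _≟_ z y
  γ = permutationAut n π
  fixes : Fixes γ A
  fixes = Fixes-permutationAut π valid (tabulate λ a∈A →
    transpose-other _≟_ (λ { refl → z∉A a∈A }) (λ { refl → y∉A a∈A }))
  y∈γx : y ∈ support (act γ x)
  y∈γx = subst (_∈ support (act γ x)) (transpose-left _≟_ z y) (∈-support-act⁺ γ x z∈x)
  y∈L : y ∈ concatMap support L
  y∈L = ∈-concatMap⁺ support (lose (orbit⊆L γ fixes) y∈γx)

proposition4p4 : (n : ℕ) → 2 ≤ n → (A : List M) → All (Valid n) A →
    (x : M) → Valid n x → (InAcl n A x ⇔ InCl A x)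
proposition4p4 n _ A valid x _ = mk⇔ acl⇒cl cl⇒acl
  where
  open Equivalence (InCl⇔support⊆supp A x)

  acl⇒cl : InAcl n A x → InCl A x
  acl⇒cl x∈acl with all? (_∈? supp A) (support x)
  ... | yes x⊆A = from x⊆A
  ... | no  x⊈A with z , z∈x , z∉A ← find (¬All⇒Any¬ (_∈? supp A) (support x) x⊈A)
    = contradiction x∈acl (∉supp⇒∉acl valid z∈x z∉A)

  cl⇒acl : InCl A x → InAcl n A x
  cl⇒acl x∈cl = relabellings (supp A) x , λ γ fixes → orbit⊆relabellings γ fixes x (to x∈cl)
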